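{- Let $k,n$ be positive integers and $G\subseteq S_k$ a subgroup. The map $p_{\mathbf{1}_G}:([n]^k,\leqslant)\to (B_{\mathbf{1}_G}(k,n),\preccurlyeq)$, $x\mapsto\overline{x}$, is order preserving.
   Context: $S_k$ acts on $[n]^k$ by $w(x)=(x_{w^{ -1}(1)},\dots,x_{w^{ -1}(k)})$; $\leqslant$ is the componentwise order on $[n]^k$. For $x\in[n]^k$, $\overline{x}$ is the lexicographic minimum of the orbit $\{g(x):g\in G\}$. $B_{\mathbf{1}_G}(k,n)=\{\overline{x}:x\in[n]^k\}$, partially ordered by $x\preccurlyeq y$ iff $x\leqslant g(y)$ for some $g\in G$. -}

module Defs where

open import Data.Nat using (ℕ)
open import Data.Fin using (Fin; _≤_; _<_)
open import Data.Fin.Permutation using (Permutation′; id; flip; _∘ₚ_; _⟨$⟩ʳ_; _⟨$⟩ˡ_)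
open import Data.Product using (Σ; ∃; _×_; _,_)
open import Data.Sum using (_⊎_)
open import Relation.Binary.PropositionalEquality using (_≡_)

Word : ℕ → ℕ → Set
Word k n = Fin k → Fin n

record IsSubgroup {k : ℕ} (G : Permutation′ k → Set) : Set where
  field
    has-id  : G id
    has-∘   : ∀ {g h} → G g → G h → G (g ∘ₚ h)
    has-inv : ∀ {g} → G g → G (flip g)

-- Action: w(x) = (x_{w⁻¹(1)}, …, x_{w⁻¹(k)})
act : ∀ {k n} → Permutation′ k → Word k n → Word k n
act w x i = x (w ⟨$⟩ˡ i)

_≤cw_ : ∀ {k n} → Word k n → Word k n → Set
x ≤cw y = ∀ i → x i ≤ y i

_≤lex_ : ∀ {k n} → Word k n → Word k n → Set
x ≤lex y = (∀ i → x i ≡ y i) ⊎ ∃ λ i → (∀ j → j < i → x j ≡ y j) × x i < y i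

InOrbit : ∀ {k n} → (Permutation′ k → Set) → Word k n → Word k n → Set
InOrbit G x m = ∃ λ g → G g × (∀ i → m i ≡ act g x i)

IsOrbitMin : ∀ {k n} → (Permutation′ k → Set) → Word k n → Word k n → Set
IsOrbitMin G x m = InOrbit G x m × (∀ z → InOrbit G x z → m ≤lex z)

_≼[_]_ : ∀ {k n} → Word k n → (Permutation′ k → Set) → Word k n → Set
x ≼[ G ] y = ∃ λ g → G g × (x ≤cw act g y)

module Submission where

open import Defs
open import Data.Nat using (ℕ; NonZero)
open import Data.Fin.Permutation using (Permutation′; flip; _∘ₚ_; _⟨$⟩ˡ_; inverseˡ)
open import Data.Fin.Properties using (≤-trans; ≤-reflexive)
open import Data.Product using (_,_)
open import Relation.Binary.PropositionalEquality using (_≗_; refl; cong; module ≡-Reasoning)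

-- Only orbit membership of x̄ and ȳ matters: if x̄ = g x and ȳ = h y, then
-- x̄ = g x ≤ g y = (h⁻¹ g)(ȳ) componentwise, and h⁻¹ g ∈ G.

module _ {k n : ℕ} where

  act-mono : (g : Permutation′ k) {x y : Word k n} → x ≤cw y → act g x ≤cw act g y
  act-mono g x≤y i = x≤y (g ⟨$⟩ˡ i)

  act-∘ : (g h : Permutation′ k) (x : Word k n) → act (g ∘ₚ h) x ≗ act h (act g x)
  act-∘ g h x i = refl

  act-flip : (h : Permutation′ k) (x : Word k n) → act (flip h) (act h x) ≗ x
  act-flip h x i = cong x (inverseˡ h)

  act-cong : (g : Permutation′ k) {x y : Word k n} → x ≗ y → act g x ≗ act g y
  act-cong g x≗y i = x≗y (g ⟨$⟩ˡ i)

  ≤cw-resp-≗ : {x x′ y y′ : Word k n} → x′ ≗ x → y ≗ y′ → x ≤cw y → x′ ≤cw y′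
  ≤cw-resp-≗ x′≗x y≗y′ x≤y i = ≤-trans (≤-reflexive (x′≗x i)) (≤-trans (x≤y i) (≤-reflexive (y≗y′ i)))

  inOrbit-≼ : (G : Permutation′ k → Set) → IsSubgroup G →
              {x y x′ y′ : Word k n} → InOrbit G x x′ → InOrbit G y y′ →
              x ≤cw y → x′ ≼[ G ] y′
  inOrbit-≼ G sg {y = y} {y′ = y′} (g , g∈G , x′≗gx) (h , h∈G , y′≗hy) x≤y =
    flip h ∘ₚ g , has-∘ (has-inv h∈G) g∈G , ≤cw-resp-≗ x′≗gx gy≗h⁻¹gy′ (act-mono g x≤y)
    where
    open IsSubgroup sg
    gy≗h⁻¹gy′ : act g y ≗ act (flip h ∘ₚ g) y′
    gy≗h⁻¹gy′ i = begin
      act g y i                        ≡⟨ act-cong g (act-flip h y) i ⟨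
      act g (act (flip h) (act h y)) i ≡⟨ act-∘ (flip h) g (act h y) i ⟨
      act (flip h ∘ₚ g) (act h y) i    ≡⟨ act-cong (flip h ∘ₚ g) y′≗hy i ⟨
      act (flip h ∘ₚ g) y′ i           ∎
      where open ≡-Reasoning

proposition5p3 : (k n : ℕ) → .{{_ : NonZero k}} → .{{_ : NonZero n}} →
    (G : Permutation′ k → Set) → IsSubgroup G →
    (x y x̄ ȳ : Word k n) → IsOrbitMin G x x̄ → IsOrbitMin G y ȳ →
    x ≤cw y → x̄ ≼[ G ] ȳ
proposition5p3 k n G sg x y x̄ ȳ (x̄∈Gx , _) (ȳ∈Gy , _) = inOrbit-≼ G sg x̄∈Gx ȳ∈Gy
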